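{- For any path $P_n$ of order $n\ge 4$, $\gamma_{tc}(M(P_n))=2n-4$.
   Context: All graphs are finite, simple and undirected. For a graph $H$, a set $D\subseteq V(H)$ is a total dominating set if every vertex of $H$ has a neighbor in $D$. A set $D\subseteq V(H)$ is a total outer-connected dominating set of $H$ if $D$ is a total dominating set and the induced subgraph $H[V(H)\setminus D]$ is connected; $\gamma_{tc}(H)$ denotes the minimum cardinality of a total outer-connected dominating set of $H$. The middle graph $M(G)$ of a graph $G$ has vertex set $V(G)\cup E(G)$, where two elements $x,y$ are adjacent iff either $x,y\in E(G)$ are edges of $G$ sharing an endpoint, or one of them is a vertex of $G$ and the other is an edge of $G$ incident to it. -}

module Defs where

open import Data.Nat using (ℕ; zero; suc; _+_; _∸_)
open import Data.Fin using (Fin; zero; suc; inject₁; splitAt)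
open import Data.Fin.Subset using (Subset; _∈_; _∉_; ∣_∣)
open import Data.Product using (_×_; _,_; proj₁; proj₂; Σ; ∃)
open import Data.Sum using (_⊎_; inj₁; inj₂)
open import Data.Empty using (⊥)
open import Relation.Nullary using (¬_)
open import Relation.Binary.PropositionalEquality using (_≡_)

record Graph : Set₁ where
  field
    order : ℕ
    Adj   : Fin order → Fin order → Set
open Graph public

-- Needed to build the middle graph,
-- whose vertices are the vertices AND the edges of G.
record EdgeGraph : Set where
  field
    nV   : ℕ
    nE   : ℕ
    ends : Fin nE → Fin nV × Fin nV
open EdgeGraph public

Incident : (G : EdgeGraph) → Fin (nV G) → Fin (nE G) → Set
Incident G v e = (proj₁ (ends G e) ≡ v) ⊎ (proj₂ (ends G e) ≡ v)

pathGraph : ℕ → EdgeGraph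
pathGraph zero    = record { nV = zero ; nE = zero ; ends = λ () }
pathGraph (suc m) = record { nV = suc m ; nE = m ; ends = λ i → inject₁ i , suc i }

-- adjacency of the middle graph M(G), vertex set V(G) ⊎ E(G) encoded as
-- Fin (nV + nE) via splitAt
MAdj' : (G : EdgeGraph) → Fin (nV G) ⊎ Fin (nE G) → Fin (nV G) ⊎ Fin (nE G) → Set
MAdj' G (inj₁ u) (inj₁ w) = ⊥
MAdj' G (inj₁ u) (inj₂ f) = Incident G u f
MAdj' G (inj₂ e) (inj₁ w) = Incident G w e
MAdj' G (inj₂ e) (inj₂ f) = ¬ (e ≡ f) × Σ (Fin (nV G)) (λ v → Incident G v e × Incident G v f)

middleGraph : EdgeGraph → Graph
middleGraph G = record
  { order = nV G + nE G
  ; Adj   = λ x y → MAdj' G (splitAt (nV G) x) (splitAt (nV G) y)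
  }

IsTotalDominating : (H : Graph) → Subset (order H) → Set
IsTotalDominating H D = (v : Fin (order H)) → Σ (Fin (order H)) (λ u → u ∈ D × Adj H v u)

data OutsideReach (H : Graph) (D : Subset (order H)) : Fin (order H) → Fin (order H) → Set where
  here : ∀ {u} → u ∉ D → OutsideReach H D u u
  step : ∀ {u w v} → u ∉ D → Adj H u w → OutsideReach H D w v → OutsideReach H D u v

-- H[V(H) \ D] is connected (vacuously true if V(H) \ D is empty)
OutsideConnected : (H : Graph) → Subset (order H) → Set
OutsideConnected H D = (u v : Fin (order H)) → u ∉ D → v ∉ D → OutsideReach H D u v

IsTOCDS : (H : Graph) → Subset (order H) → Set
IsTOCDS H D = IsTotalDominating H D × OutsideConnected H D

GammaTC≡ : Graph → ℕ → Set
GammaTC≡ H k = Σ (Subset (order H)) (λ D → IsTOCDS H D × ∣ D ∣ ≡ k)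
             × ((D : Subset (order H)) → IsTOCDS H D → k Data.Nat.≤ ∣ D ∣)

-- In M(P_n) the vertex i+1 of the path is adjacent only to the edges e_i and
-- e_{i+1}, so a total dominating set D contains one of any two consecutive
-- edges.  Hence the only elements outside D that an outside walk starting at
-- an outside edge e_i can reach are v_i, e_i and v_{i+1}; and if no edge is
-- outside D, the outside elements are pairwise non-adjacent vertices.  Either
-- way connectivity leaves at most three elements outside D, so
-- γ_tc ≥ (2n − 1) − 3.  Conversely the complement of {v_1, e_1, v_2} is a
-- total outer-connected dominating set as soon as n ≥ 4.
module Submission where

open import Defs
open import Data.Nat using (ℕ; zero; suc; _+_; _*_; _∸_; _≤_; z≤n; s≤s)
open import Data.Nat.Properties
  using (≤-reflexive; *-suc; +-identityʳ; ∸-monoʳ-≤; m∸[m∸n]≡n; module ≤-Reasoning)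
open import Data.Fin using (Fin; zero; suc; inject₁; splitAt; join)
open import Data.Fin.Properties using (any?; inject₁-injective; suc-injective; splitAt-join; join-splitAt)
open import Data.Fin.Subset using (Subset; _∈_; _∉_; ∣_∣; ⁅_⁆; _∪_; ∁; _⊆_; inside; outside)
  renaming (⊥ to ∅)
open import Data.Fin.Subset.Properties
  using ( _∈?_; nonempty?; ∪-identityˡ; x∈p∪q⁺; x∈p∪q⁻; x∈⁅x⁆; x∈⁅y⁆⇒x≡y
        ; x∈p⇒x∉∁p; x∈∁p⇒x∉p; x∉p⇒x∈∁p; x∉∁p⇒x∈p
        ; ∣p∣≤n; ∣⊥∣≡0; ∣⁅x⁆∣≡1; ∣∁p∣≡n∸∣p∣; p⊆q⇒∣p∣≤∣q∣ )
open import Data.Vec using (_∷_; here; there)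
open import Data.Product using (_×_; _,_; Σ; ∃; proj₁; proj₂)
open import Data.Sum using (_⊎_; inj₁; inj₂)
open import Data.Sum.Properties using (inj₁-injective)
open import Data.Empty using (⊥; ⊥-elim)
open import Function using (_∘_)
open import Relation.Nullary using (¬_; yes; no; ¬?)
open import Relation.Nullary.Negation using (contradiction)
open import Relation.Binary.PropositionalEquality using (_≡_; _≢_; refl; sym; trans; cong; subst; subst₂)

module _ {H : Graph} {D : Subset (order H)} where

  outsideReach-source∉ : ∀ {x y} → OutsideReach H D x y → x ∉ D
  outsideReach-source∉ (here x∉) = x∉
  outsideReach-source∉ (step x∉ _ _) = x∉

  outsideReach-trans : ∀ {x y z} → OutsideReach H D x y → OutsideReach H D y z → OutsideReach H D x z
  outsideReach-trans (here _) r = r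
  outsideReach-trans (step x∉ adj r) r′ = step x∉ adj (outsideReach-trans r r′)

  OutsideClosed : (Fin (order H) → Set) → Set
  OutsideClosed P = ∀ {x y} → P x → x ∉ D → Adj H x y → y ∉ D → P y

  outsideReach-preserves : ∀ {P} → OutsideClosed P → ∀ {x y} → OutsideReach H D x y → P x → P y
  outsideReach-preserves closed (here _) px = px
  outsideReach-preserves closed (step x∉ adj r) px =
    outsideReach-preserves closed r (closed px x∉ adj (outsideReach-source∉ r))

x∉p⇒∣⁅x⁆∪p∣≡1+∣p∣ : ∀ {n} (x : Fin n) (p : Subset n) → x ∉ p → ∣ ⁅ x ⁆ ∪ p ∣ ≡ suc ∣ p ∣
x∉p⇒∣⁅x⁆∪p∣≡1+∣p∣ zero    (outside ∷ p) _   = cong (suc ∘ ∣_∣) (∪-identityˡ p)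
x∉p⇒∣⁅x⁆∪p∣≡1+∣p∣ zero    (inside  ∷ p) x∉p = contradiction here x∉p
x∉p⇒∣⁅x⁆∪p∣≡1+∣p∣ (suc x) (outside ∷ p) x∉p = x∉p⇒∣⁅x⁆∪p∣≡1+∣p∣ x p (x∉p ∘ there)
x∉p⇒∣⁅x⁆∪p∣≡1+∣p∣ (suc x) (inside  ∷ p) x∉p = cong suc (x∉p⇒∣⁅x⁆∪p∣≡1+∣p∣ x p (x∉p ∘ there))

∁p⊆q⇒n∸k≤∣p∣ : ∀ {n k} {p q : Subset n} → ∁ p ⊆ q → ∣ q ∣ ≤ k → n ∸ k ≤ ∣ p ∣
∁p⊆q⇒n∸k≤∣p∣ {n} {k} {p} {q} ∁p⊆q ∣q∣≤k = begin
  n ∸ k          ≤⟨ ∸-monoʳ-≤ n ∣q∣≤k ⟩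
  n ∸ ∣ q ∣      ≤⟨ ∸-monoʳ-≤ n (p⊆q⇒∣p∣≤∣q∣ ∁p⊆q) ⟩
  n ∸ ∣ ∁ p ∣    ≡⟨ cong (n ∸_) (∣∁p∣≡n∸∣p∣ p) ⟩
  n ∸ (n ∸ ∣ p ∣) ≡⟨ m∸[m∸n]≡n (∣p∣≤n p) ⟩
  ∣ p ∣          ∎
  where open ≤-Reasoning

inject₁≢suc : ∀ {n} (i : Fin n) → inject₁ i ≢ suc i
inject₁≢suc zero    ()
inject₁≢suc (suc i) = inject₁≢suc i ∘ suc-injective

module MiddleGraphOfPath (m : ℕ) where

  G : EdgeGraph
  G = pathGraph (suc m)

  H : Graph
  H = middleGraph G

  El : Set
  El = Fin (suc m) ⊎ Fin m

  split : Fin (order H) → El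
  split = splitAt (suc m)

  -- Opaque so that unification can recover s from ⌜ s ⌝.
  opaque
    ⌜_⌝ : El → Fin (order H)
    ⌜_⌝ = join (suc m) m

    ⌜split⌝ : ∀ x → ⌜ split x ⌝ ≡ x
    ⌜split⌝ = join-splitAt (suc m) m

    split⌜⌝ : ∀ s → split ⌜ s ⌝ ≡ s
    split⌜⌝ = splitAt-join (suc m) m

  MAdj⇒Adj : ∀ {s t} → MAdj' G s t → Adj H ⌜ s ⌝ ⌜ t ⌝
  MAdj⇒Adj {s} {t} = subst₂ (MAdj' G) (sym (split⌜⌝ s)) (sym (split⌜⌝ t))

  Adj⇒MAdj : ∀ {s u} → Adj H ⌜ s ⌝ u → MAdj' G s (split u)
  Adj⇒MAdj {s} {u} = subst (λ r → MAdj' G r (split u)) (split⌜⌝ s)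

  ∈⁅⌜⌝⁆⇒split≡ : ∀ {x t} → x ∈ ⁅ ⌜ t ⌝ ⁆ → split x ≡ t
  ∈⁅⌜⌝⁆⇒split≡ {t = t} x∈ = trans (cong split (x∈⁅y⁆⇒x≡y ⌜ t ⌝ x∈)) (split⌜⌝ t)

  ⌜⌝∉⁅⌜⌝⁆ : ∀ s t → s ≢ t → ⌜ s ⌝ ∉ ⁅ ⌜ t ⌝ ⁆
  ⌜⌝∉⁅⌜⌝⁆ s t s≢t = s≢t ∘ trans (sym (split⌜⌝ s)) ∘ ∈⁅⌜⌝⁆⇒split≡

  data OnEdge (i : Fin m) : El → Set where
    left  : OnEdge i (inj₁ (inject₁ i))
    edge  : OnEdge i (inj₂ i)
    right : OnEdge i (inj₁ (suc i))

  incident⇒onEdge : ∀ {v i} → Incident G v i → OnEdge i (inj₁ v)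
  incident⇒onEdge (inj₁ refl) = left
  incident⇒onEdge (inj₂ refl) = right

  segment : Fin m → Subset (order H)
  segment i = ⁅ ⌜ inj₁ (inject₁ i) ⌝ ⁆ ∪ (⁅ ⌜ inj₂ i ⌝ ⁆ ∪ ⁅ ⌜ inj₁ (suc i) ⌝ ⁆)

  onEdge⇒∈segment : ∀ {i s} → OnEdge i s → ⌜ s ⌝ ∈ segment i
  onEdge⇒∈segment left  = x∈p∪q⁺ (inj₁ (x∈⁅x⁆ _))
  onEdge⇒∈segment edge  = x∈p∪q⁺ (inj₂ (x∈p∪q⁺ (inj₁ (x∈⁅x⁆ _))))
  onEdge⇒∈segment right = x∈p∪q⁺ (inj₂ (x∈p∪q⁺ (inj₂ (x∈⁅x⁆ _))))

  ∈segment⇒onEdge : ∀ {i x} → x ∈ segment i → OnEdge i (split x)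
  ∈segment⇒onEdge {i} {x} x∈ with x∈p∪q⁻ _ _ x∈
  ... | inj₁ x∈l = subst (OnEdge i) (sym (∈⁅⌜⌝⁆⇒split≡ x∈l)) left
  ... | inj₂ x∈er with x∈p∪q⁻ _ _ x∈er
  ...   | inj₁ x∈e = subst (OnEdge i) (sym (∈⁅⌜⌝⁆⇒split≡ x∈e)) edge
  ...   | inj₂ x∈r = subst (OnEdge i) (sym (∈⁅⌜⌝⁆⇒split≡ x∈r)) right

  ∣segment∣≡3 : ∀ i → ∣ segment i ∣ ≡ 3
  ∣segment∣≡3 i = trans (x∉p⇒∣⁅x⁆∪p∣≡1+∣p∣ _ _ left∉)
                        (cong suc (trans (x∉p⇒∣⁅x⁆∪p∣≡1+∣p∣ _ _ edge∉) (cong suc (∣⁅x⁆∣≡1 ⌜ inj₁ (suc i) ⌝))))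
    where
    edge∉ : ⌜ inj₂ i ⌝ ∉ ⁅ ⌜ inj₁ (suc i) ⌝ ⁆
    edge∉ = ⌜⌝∉⁅⌜⌝⁆ (inj₂ i) (inj₁ (suc i)) λ ()
    left∉ : ⌜ inj₁ (inject₁ i) ⌝ ∉ ⁅ ⌜ inj₂ i ⌝ ⁆ ∪ ⁅ ⌜ inj₁ (suc i) ⌝ ⁆
    left∉ x∈ with x∈p∪q⁻ ⁅ ⌜ inj₂ i ⌝ ⁆ ⁅ ⌜ inj₁ (suc i) ⌝ ⁆ x∈
    ... | inj₁ x∈e = ⌜⌝∉⁅⌜⌝⁆ (inj₁ (inject₁ i)) (inj₂ i) (λ ()) x∈e
    ... | inj₂ x∈r = ⌜⌝∉⁅⌜⌝⁆ (inj₁ (inject₁ i)) (inj₁ (suc i)) (inject₁≢suc i ∘ inj₁-injective) x∈r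

  module LowerBound (D : Subset (order H)) (toc : IsTOCDS H D) where

    private
      td : IsTotalDominating H D
      td = proj₁ toc

      oc : OutsideConnected H D
      oc = proj₂ toc

    split-∉ : ∀ {y} → y ∉ D → ⌜ split y ⌝ ∉ D
    split-∉ {y} = subst (_∉ D) (sym (⌜split⌝ y))

    -- The path vertex suc i sees only the edges i and f, and needs a neighbour in D.
    consecutive-edge-∈ : ∀ {i f} → ⌜ inj₂ i ⌝ ∉ D → inject₁ f ≡ suc i → ⌜ inj₂ f ⌝ ∈ D
    consecutive-edge-∈ {i} {f} i∉ f~i with td ⌜ inj₁ (suc i) ⌝
    ... | u , u∈ , adj = dominator (split u) (subst (_∈ D) (sym (⌜split⌝ u)) u∈) (Adj⇒MAdj {u = u} adj)
      where
      dominator : ∀ t → ⌜ t ⌝ ∈ D → MAdj' G (inj₁ (suc i)) t → ⌜ inj₂ f ⌝ ∈ D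
      dominator (inj₂ g) g∈ (inj₁ g~i) = subst (λ e → ⌜ inj₂ e ⌝ ∈ D) (inject₁-injective (trans g~i (sym f~i))) g∈
      dominator (inj₂ g) g∈ (inj₂ g≡i) = contradiction (subst (λ e → ⌜ inj₂ e ⌝ ∈ D) (suc-injective g≡i) g∈) i∉

    onEdge-closed : ∀ {i s} → ⌜ inj₂ i ⌝ ∉ D → OnEdge i s → ∀ {t} → MAdj' G s t → ⌜ t ⌝ ∉ D → OnEdge i t
    onEdge-closed i∉ left {inj₂ f} (inj₁ f~i) _ with inject₁-injective f~i
    ... | refl = edge
    onEdge-closed i∉ left {inj₂ f} (inj₂ i~f) f∉ = contradiction (consecutive-edge-∈ f∉ (sym i~f)) i∉
    onEdge-closed i∉ right {inj₂ f} (inj₁ f~i) f∉ = contradiction (consecutive-edge-∈ i∉ f~i) f∉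
    onEdge-closed i∉ right {inj₂ f} (inj₂ f≡i) _ with suc-injective f≡i
    ... | refl = edge
    onEdge-closed i∉ edge {inj₁ w} inc _ = incident⇒onEdge inc
    onEdge-closed i∉ edge {inj₂ f} (i≢f , _ , inj₁ refl , inj₁ f~i) _ = ⊥-elim (i≢f (sym (inject₁-injective f~i)))
    onEdge-closed i∉ edge {inj₂ f} (i≢f , _ , inj₁ refl , inj₂ i~f) f∉ = contradiction (consecutive-edge-∈ f∉ (sym i~f)) i∉
    onEdge-closed i∉ edge {inj₂ f} (i≢f , _ , inj₂ refl , inj₁ f~i) f∉ = contradiction (consecutive-edge-∈ i∉ f~i) f∉
    onEdge-closed i∉ edge {inj₂ f} (i≢f , _ , inj₂ refl , inj₂ f≡i) _ = ⊥-elim (i≢f (sym (suc-injective f≡i)))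

    outside⊆segment : ∀ {i} → ⌜ inj₂ i ⌝ ∉ D → ∁ D ⊆ segment i
    outside⊆segment {i} i∉ {w} w∈ =
      subst (_∈ segment i) (⌜split⌝ w) (onEdge⇒∈segment (outsideReach-preserves closed (oc _ w i∉ (x∈∁p⇒x∉p w∈)) start))
      where
      closed : OutsideClosed {H} {D} (λ x → OnEdge i (split x))
      closed p _ adj y∉ = onEdge-closed i∉ p adj (split-∉ y∉)
      start : OnEdge i (split ⌜ inj₂ i ⌝)
      start = subst (OnEdge i) (sym (split⌜⌝ (inj₂ i))) edge

    -- Every adjacency of M(G) has an edge of G at one of its ends.
    outside-isolated : (¬ ∃ λ e → ⌜ inj₂ e ⌝ ∉ D) → ∀ {s t} → MAdj' G s t → ⌜ s ⌝ ∉ D → ⌜ t ⌝ ∉ D → ⊥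
    outside-isolated no-edge {inj₁ _} {inj₂ f} _ _ f∉ = no-edge (f , f∉)
    outside-isolated no-edge {inj₂ e} {_}      _ e∉ _ = no-edge (e , e∉)

    outside⊆singleton : (¬ ∃ λ e → ⌜ inj₂ e ⌝ ∉ D) → ∀ {x} → x ∉ D → ∁ D ⊆ ⁅ x ⁆
    outside⊆singleton no-edge {x} x∉ {w} w∈ =
      subst (_∈ ⁅ x ⁆) (outsideReach-preserves closed (oc x w x∉ (x∈∁p⇒x∉p w∈)) refl) (x∈⁅x⁆ x)
      where
      closed : OutsideClosed {H} {D} (x ≡_)
      closed _ y∉ adj z∉ = ⊥-elim (outside-isolated no-edge adj (split-∉ y∉) (split-∉ z∉))

    outside-small : Σ (Subset (order H)) λ S → ∁ D ⊆ S × ∣ S ∣ ≤ 3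
    outside-small with nonempty? (∁ D)
    ... | no empty = ∅ , (λ {x} x∈ → ⊥-elim (empty (x , x∈))) , subst (_≤ 3) (sym (∣⊥∣≡0 (order H))) z≤n
    ... | yes (x , x∈) with any? (λ e → ¬? (⌜ inj₂ e ⌝ ∈? D))
    ...   | yes (i , i∉) = segment i , outside⊆segment i∉ , ≤-reflexive (∣segment∣≡3 i)
    ...   | no no-edge  = ⁅ x ⁆ , outside⊆singleton no-edge (x∈∁p⇒x∉p x∈) , subst (_≤ 3) (sym (∣⁅x⁆∣≡1 x)) (s≤s z≤n)

    lower-bound : order H ∸ 3 ≤ ∣ D ∣
    lower-bound with outside-small
    ... | S , ∁D⊆S , ∣S∣≤3 = ∁p⊆q⇒n∸k≤∣p∣ ∁D⊆S ∣S∣≤3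

  segment-outsideConnected : ∀ i → OutsideConnected H (∁ (segment i))
  segment-outsideConnected i x y x∉ y∉ =
    subst₂ (OutsideReach H (∁ (segment i))) (⌜split⌝ x) (⌜split⌝ y)
      (outsideReach-trans (to-edge (∈segment⇒onEdge (x∉∁p⇒x∈p x∉))) (from-edge (∈segment⇒onEdge (x∉∁p⇒x∈p y∉))))
    where
    out : ∀ {s} → OnEdge i s → ⌜ s ⌝ ∉ ∁ (segment i)
    out = x∈p⇒x∉∁p ∘ onEdge⇒∈segment
    to-edge : ∀ {s} → OnEdge i s → OutsideReach H (∁ (segment i)) ⌜ s ⌝ ⌜ inj₂ i ⌝
    to-edge left  = step (out left) (MAdj⇒Adj (inj₁ refl)) (here (out edge))
    to-edge edge  = here (out edge)
    to-edge right = step (out right) (MAdj⇒Adj (inj₂ refl)) (here (out edge))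
    from-edge : ∀ {s} → OnEdge i s → OutsideReach H (∁ (segment i)) ⌜ inj₂ i ⌝ ⌜ s ⌝
    from-edge left  = step (out edge) (MAdj⇒Adj (inj₁ refl)) (here (out left))
    from-edge edge  = here (out edge)
    from-edge right = step (out edge) (MAdj⇒Adj (inj₂ refl)) (here (out right))

module MiddleGraphOfLongPath (k : ℕ) where

  open MiddleGraphOfPath (3 + k)

  e₁ : Fin (3 + k)
  e₁ = suc zero

  -- The vertex v₂ needs the edge e₂, i.e. n ≥ 4.
  neighbour-off-segment : ∀ s → Σ El λ t → ¬ OnEdge e₁ t × MAdj' G s t
  neighbour-off-segment (inj₁ zero)                = inj₂ zero , (λ ()) , inj₁ refl
  neighbour-off-segment (inj₁ (suc zero))          = inj₂ zero , (λ ()) , inj₂ refl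
  neighbour-off-segment (inj₁ (suc (suc zero)))    = inj₂ (suc (suc zero)) , (λ ()) , inj₁ refl
  neighbour-off-segment (inj₁ (suc (suc (suc v)))) = inj₂ (suc (suc v)) , (λ ()) , inj₂ refl
  neighbour-off-segment (inj₂ zero)                = inj₁ zero , (λ ()) , inj₁ refl
  neighbour-off-segment (inj₂ (suc zero))          = inj₂ zero , (λ ()) , (λ ()) , suc zero , inj₁ refl , inj₂ refl
  neighbour-off-segment (inj₂ (suc (suc e)))       = inj₁ (suc (suc (suc e))) , (λ ()) , inj₂ refl

  segment-totalDominating : IsTotalDominating H (∁ (segment e₁))
  segment-totalDominating x with neighbour-off-segment (split x)
  ... | t , t∉ , adj = ⌜ t ⌝ , x∉p⇒x∈∁p (t∉ ∘ subst (OnEdge e₁) (split⌜⌝ t) ∘ ∈segment⇒onEdge) ,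
                       subst (MAdj' G (split x)) (sym (split⌜⌝ t)) adj

  γtc≡order∸3 : GammaTC≡ H (order H ∸ 3)
  γtc≡order∸3 =
    (∁ (segment e₁) , (segment-totalDominating , segment-outsideConnected e₁) ,
       trans (∣∁p∣≡n∸∣p∣ (segment e₁)) (cong (order H ∸_) (∣segment∣≡3 e₁))) ,
    λ D toc → LowerBound.lower-bound D toc

2*[1+m]≡1+[[1+m]+m] : ∀ m → 2 * suc m ≡ suc (suc m + m)
2*[1+m]≡1+[[1+m]+m] m = trans (*-suc 2 m) (cong (λ j → 2 + (m + j)) (+-identityʳ m))

theorem3p7 : (n : ℕ) → 4 ≤ n → GammaTC≡ (middleGraph (pathGraph n)) (2 * n ∸ 4)
theorem3p7 (suc (suc (suc (suc k)))) _ =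
  subst (GammaTC≡ _) (sym (cong (_∸ 4) (2*[1+m]≡1+[[1+m]+m] (3 + k)))) (MiddleGraphOfLongPath.γtc≡order∸3 k)
theorem3p7 0 ()
theorem3p7 1 (s≤s ())
theorem3p7 2 (s≤s (s≤s ()))
theorem3p7 3 (s≤s (s≤s (s≤s ())))
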